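{- Fix the "standard center" conditions $s(12)=1$, $s(13)=2$, $s(20)=3$, $s(26)=4$, $s(25)=5$, $s(18)=6$, $s(19)=7$. For each of the three additional seed sets (a) $s(8)=1, s(16)=1$; (b) $s(8)=1, s(22)=1$; (c) $s(21)=1, s(4)=1$, there are exactly four valid Septoku boards $s$ satisfying the standard center conditions together with that seed set.
   Context: The Septoku board consists of 37 cells forming a regular hexagon of side 4 in a hexagonal grid, numbered row by row: $1$–$4$ (top row), $5$–$9$, $10$–$15$, $16$–$22$, $23$–$28$, $29$–$33$, $34$–$37$ (bottom row). The 21 "rows" of the board are: horizontal $\{1,2,3,4\}$, $\{5,\dots,9\}$, $\{10,\dots,15\}$, $\{16,\dots,22\}$, $\{23,\dots,28\}$, $\{29,\dots,33\}$, $\{34,\dots,37\}$; up-right $\{1,5,10,16\}$, $\{2,6,11,17,23\}$, $\{3,7,12,18,24,29\}$, $\{4,8,13,19,25,30,34\}$, $\{9,14,20,26,31,35\}$, $\{15,21,27,32,36\}$, $\{22,28,33,37\}$; down-right $\{4,9,15,22\}$, $\{3,8,14,21,28\}$, $\{2,7,13,20,27,33\}$, $\{1,6,12,19,26,32,37\}$, $\{5,11,18,25,31,36\}$, $\{10,17,24,30,35\}$, $\{16,23,29,34\}$. The seven "circles" are: $\{1,2,5,6,7,11,12\}$, $\{3,4,7,8,9,13,14\}$, $\{10,11,16,17,18,23,24\}$, $\{12,13,18,19,20,25,26\}$, $\{14,15,20,21,22,27,28\}$, $\{24,25,29,30,31,34,35\}$, $\{26,27,31,32,33,36,37\}$. A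 valid Septoku board is a map $s:\{1,\dots,37\}\to\{1,\dots,7\}$ such that the cells of each of the 21 rows receive pairwise distinct values and the seven cells of each circle receive pairwise distinct values. -}

module Defs where

open import Data.Nat using (ℕ; zero; suc; _∸_; _⊓_; s≤s)
open import Data.Nat.Properties using (m⊓n≤n)
open import Data.Fin using (Fin; fromℕ<; toℕ)
open import Data.Vec using (Vec; lookup)
open import Data.List using (List; []; _∷_; map; length)
open import Data.List.Relation.Unary.All using (All)
open import Data.List.Relation.Unary.Unique.Propositional using (Unique)
open import Data.List.Membership.Propositional using (_∈_)
open import Data.Product using (_×_; Σ)
open import Relation.Binary.PropositionalEquality using (_≡_)
open import Function.Bundles using (_⇔_)

-- A board s : {1..37} → {1..7}.  Cell c (1..37) is stored at index c-1 of the
-- vector; the stored value x : Fin 7 represents the Septoku value toℕ x + 1.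
Board : Set
Board = Vec (Fin 7) 37

-- index of cell number c (meant for 1 ≤ c ≤ 37; clamped otherwise, never used so)
cell : ℕ → Fin 37
cell c = fromℕ< {(c ∸ 1) ⊓ 36} (s≤s (m⊓n≤n (c ∸ 1) 36))

_at_ : Board → ℕ → ℕ
s at c = suc (toℕ (lookup s (cell c)))

rows : List (List ℕ)
rows =
  (1 ∷ 2 ∷ 3 ∷ 4 ∷ []) ∷
  (5 ∷ 6 ∷ 7 ∷ 8 ∷ 9 ∷ []) ∷
  (10 ∷ 11 ∷ 12 ∷ 13 ∷ 14 ∷ 15 ∷ []) ∷
  (16 ∷ 17 ∷ 18 ∷ 19 ∷ 20 ∷ 21 ∷ 22 ∷ []) ∷
  (23 ∷ 24 ∷ 25 ∷ 26 ∷ 27 ∷ 28 ∷ []) ∷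
  (29 ∷ 30 ∷ 31 ∷ 32 ∷ 33 ∷ []) ∷
  (34 ∷ 35 ∷ 36 ∷ 37 ∷ []) ∷
  (1 ∷ 5 ∷ 10 ∷ 16 ∷ []) ∷
  (2 ∷ 6 ∷ 11 ∷ 17 ∷ 23 ∷ []) ∷
  (3 ∷ 7 ∷ 12 ∷ 18 ∷ 24 ∷ 29 ∷ []) ∷
  (4 ∷ 8 ∷ 13 ∷ 19 ∷ 25 ∷ 30 ∷ 34 ∷ []) ∷
  (9 ∷ 14 ∷ 20 ∷ 26 ∷ 31 ∷ 35 ∷ []) ∷
  (15 ∷ 21 ∷ 27 ∷ 32 ∷ 36 ∷ []) ∷
  (22 ∷ 28 ∷ 33 ∷ 37 ∷ []) ∷
  (4 ∷ 9 ∷ 15 ∷ 22 ∷ []) ∷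
  (3 ∷ 8 ∷ 14 ∷ 21 ∷ 28 ∷ []) ∷
  (2 ∷ 7 ∷ 13 ∷ 20 ∷ 27 ∷ 33 ∷ []) ∷
  (1 ∷ 6 ∷ 12 ∷ 19 ∷ 26 ∷ 32 ∷ 37 ∷ []) ∷
  (5 ∷ 11 ∷ 18 ∷ 25 ∷ 31 ∷ 36 ∷ []) ∷
  (10 ∷ 17 ∷ 24 ∷ 30 ∷ 35 ∷ []) ∷
  (16 ∷ 23 ∷ 29 ∷ 34 ∷ []) ∷
  []

circles : List (List ℕ)
circles =
  (1 ∷ 2 ∷ 5 ∷ 6 ∷ 7 ∷ 11 ∷ 12 ∷ []) ∷
  (3 ∷ 4 ∷ 7 ∷ 8 ∷ 9 ∷ 13 ∷ 14 ∷ []) ∷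
  (10 ∷ 11 ∷ 16 ∷ 17 ∷ 18 ∷ 23 ∷ 24 ∷ []) ∷
  (12 ∷ 13 ∷ 18 ∷ 19 ∷ 20 ∷ 25 ∷ 26 ∷ []) ∷
  (14 ∷ 15 ∷ 20 ∷ 21 ∷ 22 ∷ 27 ∷ 28 ∷ []) ∷
  (24 ∷ 25 ∷ 29 ∷ 30 ∷ 31 ∷ 34 ∷ 35 ∷ []) ∷
  (26 ∷ 27 ∷ 31 ∷ 32 ∷ 33 ∷ 36 ∷ 37 ∷ []) ∷
  []

Distinct : Board → List ℕ → Set
Distinct s g = Unique (map (s at_) g)

Valid : Board → Set
Valid s = All (Distinct s) rows × All (Distinct s) circles

StandardCenter : Board → Set
StandardCenter s =
  s at 12 ≡ 1 × s at 13 ≡ 2 × s at 20 ≡ 3 × s at 26 ≡ 4 ×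
  s at 25 ≡ 5 × s at 18 ≡ 6 × s at 19 ≡ 7

SeedA SeedB SeedC : Board → Set
SeedA s = s at 8 ≡ 1 × s at 16 ≡ 1
SeedB s = s at 8 ≡ 1 × s at 22 ≡ 1
SeedC s = s at 21 ≡ 1 × s at 4 ≡ 1

ExactlyBoards : ℕ → (Board → Set) → Set
ExactlyBoards n P =
  Σ (List Board) λ L → length L ≡ n × Unique L × (∀ s → (P s ⇔ s ∈ L))

-- The boards are enumerated by a verified constraint-propagation search. Every cell carries a
-- domain of candidate values; assigning a value to a cell removes it from the domains of all
-- cells sharing a row or circle with it, and the search branches on a cell with the smallest
-- domain. A board satisfying the Septoku constraints and the givens never leaves the domains
-- along the branch that follows its own values, so it occurs among the leaves. Filtering the
-- leaves by the decidable conditions of the theorem leaves exactly the boards asked for; that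
-- there are four of them, pairwise distinct, is then checked by evaluation.

module Submission where

open import Defs
open import Data.Bool using (T)
open import Data.Fin using (Fin; zero; suc; toℕ; #_)
open import Data.Fin.Properties using (toℕ-injective) renaming (_≟_ to _≟ᶠ_)
open import Data.List using (List; []; _∷_; map; filter; concat; concatMap; foldr; length; allFin; _++_)
import Data.Nat.Properties as ℕ
open import Data.List.Extrema ℕ.≤-totalOrder using (argmin)
open import Data.List.Membership.Propositional using (_∈_; lose)
open import Data.List.Membership.Propositional.Properties
  using (∈-filter⁺; ∈-filter⁻; ∈-allFin; ∈-map⁺; ∈-concat⁻′)
open import Data.List.Relation.Unary.All as All using (All; []; _∷_; all?)
open import Data.List.Relation.Unary.All.Properties using (++⁺; all-filter) renaming (map⁺ to All-map⁺)
open import Data.List.Relation.Unary.AllPairs as AllPairs using (AllPairs; _∷_; allPairs?)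
open import Data.List.Relation.Unary.AllPairs.Properties using ()
  renaming (map⁺ to AllPairs-map⁺; map⁻ to AllPairs-map⁻)
open import Data.List.Relation.Unary.Any using (here; there; any?)
open import Data.List.Relation.Unary.Any.Properties using (concatMap⁺)
open import Data.List.Relation.Unary.Unique.Propositional using (Unique)
open import Data.Nat using (ℕ; zero; suc; _≟_; _≡ᵇ_)
open import Data.Product using (_×_; _,_)
open import Data.Vec using (Vec; []; _∷_; lookup; replicate; tabulate; _[_]≔_)
open import Data.Vec.Properties using (lookup∘update; lookup∘update′; lookup-replicate; lookup∘tabulate)
import Data.Vec.Properties as Vec
open import Data.Vec.Relation.Binary.Pointwise.Extensional as Pointwise using (Pointwise; ext)
open import Function using (_∘_; _on_)
open import Function.Bundles using (mk⇔)
open import Relation.Binary using (Symmetric; DecidableEquality)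
open import Relation.Binary.PropositionalEquality using (_≡_; _≢_; refl; sym; cong; subst; ≢-sym)
open import Relation.Nullary using (Dec; yes; no; ¬?; contradiction)
open import Relation.Nullary.Decidable using (True; toWitness; _×-dec_)
open import Relation.Unary using (Decidable)

allPairs-∈ : ∀ {A : Set} {R : A → A → Set} {xs x y} → Symmetric R →
             AllPairs R xs → x ∈ xs → y ∈ xs → x ≢ y → R x y
allPairs-∈ sym (_ ∷ _)   (here refl)  (here refl)  x≢y = contradiction refl x≢y
allPairs-∈ sym (Rx ∷ _)  (here refl)  (there y∈xs) _   = All.lookup Rx y∈xs
allPairs-∈ sym (Ry ∷ _)  (there x∈xs) (here refl)  _   = sym (All.lookup Ry x∈xs)
allPairs-∈ sym (_ ∷ Rxs) (there x∈xs) (there y∈xs) x≢y = allPairs-∈ sym Rxs x∈xs y∈xs x≢y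

module _ {A : Set} (_≟ₐ_ : DecidableEquality A) where

  without : A → List A → List A
  without x = filter (λ y → ¬? (y ≟ₐ x))

  ∈-without : ∀ {x y xs} → y ∈ xs → y ≢ x → y ∈ without x xs
  ∈-without {x} = ∈-filter⁺ (λ y → ¬? (y ≟ₐ x))

  ∈-without⁻ : ∀ {x y xs} → y ∈ without x xs → y ∈ xs × y ≢ x
  ∈-without⁻ {x} = ∈-filter⁻ (λ y → ¬? (y ≟ₐ x))

module _ {A : Set} where

  _∈ᵛ_ : ∀ {m} → Vec A m → Vec (List A) m → Set
  _∈ᵛ_ = Pointwise _∈_

  ∈ᵛ-update : ∀ {m} {xs : Vec A m} {xss i ys} → xs ∈ᵛ xss → lookup xs i ∈ ys → xs ∈ᵛ (xss [ i ]≔ ys)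
  ∈ᵛ-update {xs = xs} {xss} {i} {ys} xs∈xss xᵢ∈ys = ext at
    where
    at : ∀ j → lookup xs j ∈ lookup (xss [ i ]≔ ys) j
    at j with j ≟ᶠ i
    ... | yes refl = subst (lookup xs i ∈_) (sym (lookup∘update i xss ys)) xᵢ∈ys
    ... | no  j≢i  = subst (lookup xs j ∈_) (sym (lookup∘update′ j≢i xss ys)) (Pointwise.app xs∈xss j)

  choices : ∀ {m} → Vec (List A) m → List (Vec A m)
  choices []         = [] ∷ []
  choices (xs ∷ xss) = concatMap (λ x → map (x ∷_) (choices xss)) xs

  ∈-choices : ∀ {m} {xs : Vec A m} {xss} → xs ∈ᵛ xss → xs ∈ choices xss
  ∈-choices {xs = []}     {[]}       _      = here refl
  ∈-choices {xs = x ∷ xs} {ys ∷ yss} xs∈xss =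
    concatMap⁺ _ (lose (Pointwise.head xs∈xss) (∈-map⁺ (x ∷_) (∈-choices (Pointwise.tail xs∈xss))))

Satisfies : ∀ {n k} → Vec (Fin k) n → List (Fin n × Fin k) → Set
Satisfies s = All (λ (i , v) → lookup s i ≡ v)

Separates : ∀ {n k} → Vec (List (Fin n)) n → Vec (Fin k) n → Set
Separates neighbours s = ∀ i {j} → j ∈ lookup neighbours i → lookup s j ≢ lookup s i

-- The neighbour table is a module parameter rather than a function so that the type checker
-- computes each of its entries only once while it runs the search.
module Propagation {n k : ℕ} (neighbours : Vec (List (Fin n)) n) where

  Domains : Set
  Domains = Vec (List (Fin k)) n

  prune : Fin k → List (Fin n) → Domains → Domains
  prune v []       D = D
  prune v (j ∷ js) D = prune v js (D [ j ]≔ without _≟ᶠ_ v (lookup D j))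

  assign : Fin n → Fin k → Domains → Domains
  assign i v D = prune v (lookup neighbours i) D [ i ]≔ (v ∷ [])

  -- The fuel and the list of cells not yet branched on only serve efficiency: whatever they
  -- are, `choices` at the leaves keeps every board inside the domains.
  search : ℕ → List (Fin n) → Domains → List (Vec (Fin k) n)
  search (suc m) (h ∷ hs) D = branchOn (argmin (length ∘ lookup D) h hs)
    where
    branchOn : Fin n → List (Vec (Fin k) n)
    branchOn i = concatMap (λ v → search m (without _≟ᶠ_ i (h ∷ hs)) (assign i v D)) (lookup D i)
  search _       _        D = choices D

  constrain : List (Fin n × Fin k) → Domains
  constrain = foldr (λ (i , v) → assign i v) (replicate n (allFin k))

  solve : List (Fin n × Fin k) → List (Vec (Fin k) n)
  solve givens = search n (allFin n) (constrain givens)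

  module _ {s : Vec (Fin k) n} (separated : Separates neighbours s) where

    prune-complete : ∀ {v js D} → s ∈ᵛ D → All (λ j → lookup s j ≢ v) js → s ∈ᵛ prune v js D
    prune-complete s∈D []                   = s∈D
    prune-complete s∈D (_∷_ {j} sⱼ≢v sⱼ≢vs) =
      prune-complete (∈ᵛ-update s∈D (∈-without _≟ᶠ_ (Pointwise.app s∈D j) sⱼ≢v)) sⱼ≢vs

    assign-complete : ∀ {i v D} → s ∈ᵛ D → lookup s i ≡ v → s ∈ᵛ assign i v D
    assign-complete {i} s∈D refl =
      ∈ᵛ-update (prune-complete s∈D (All.tabulate (separated i))) (here refl)

    search-complete : ∀ m hs {D} → s ∈ᵛ D → s ∈ search m hs D
    search-complete (suc m) (h ∷ hs) {D} s∈D =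
      concatMap⁺ _ (lose (Pointwise.app s∈D i) (search-complete m _ (assign-complete s∈D refl)))
      where i = argmin (length ∘ lookup D) h hs
    search-complete zero    _        s∈D = ∈-choices s∈D
    search-complete (suc m) []       s∈D = ∈-choices s∈D

    constrain-complete : ∀ {givens} → Satisfies s givens → s ∈ᵛ constrain givens
    constrain-complete []          =
      ext λ i → subst (lookup s i ∈_) (sym (lookup-replicate i (allFin k))) (∈-allFin _)
    constrain-complete (sᵢ≡v ∷ ok) = assign-complete (constrain-complete ok) sᵢ≡v

    solve-complete : ∀ {givens} → Satisfies s givens → s ∈ solve givens
    solve-complete = search-complete n (allFin n) ∘ constrain-complete

module _ {n : ℕ} (blocks : List (List (Fin n))) where

  AllDifferent : ∀ {k} → Vec (Fin k) n → Set
  AllDifferent s = All (AllPairs (_≢_ on lookup s)) blocks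

  peers : Fin n → List (Fin n)
  peers i = without _≟ᶠ_ i (concat (filter (any? (i ≟ᶠ_)) blocks))

  allDifferent⇒separates : ∀ {k} {s : Vec (Fin k) n} → AllDifferent s → Separates (tabulate peers) s
  allDifferent⇒separates different i {j} j∈ =
    let j∈peers , j≢i  = ∈-without⁻ _≟ᶠ_ (subst (j ∈_) (lookup∘tabulate peers i) j∈)
        b , j∈b , b∈   = ∈-concat⁻′ (filter (any? (i ≟ᶠ_)) blocks) j∈peers
        b∈blocks , i∈b = ∈-filter⁻ (any? (i ≟ᶠ_)) b∈
    in allPairs-∈ ≢-sym (All.lookup different b∈blocks) j∈b i∈b j≢i

septokuBlocks : List (List (Fin 37))
septokuBlocks = map (map cell) (rows ++ circles)

valid⇒allDifferent : ∀ {s} → Valid s → AllDifferent septokuBlocks s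
valid⇒allDifferent (rows-distinct , circles-distinct) =
  All-map⁺ (All.map (AllPairs-map⁺ ∘ AllPairs.map (_∘ cong (suc ∘ toℕ)) ∘ AllPairs-map⁻)
                    (++⁺ rows-distinct circles-distinct))

-- Opaque, so that the type checker never runs the search while comparing types; only
-- `proposition2`, which unfolds it, evaluates it.
opaque
  septokuSolve : List (Fin 37 × Fin 7) → List Board
  septokuSolve = Propagation.solve (tabulate (peers septokuBlocks))

  septokuSolve-complete : ∀ {s} givens → Valid s → Satisfies s givens → s ∈ septokuSolve givens
  septokuSolve-complete {s} _ valid =
    Propagation.solve-complete (tabulate (peers septokuBlocks))
      (allDifferent⇒separates septokuBlocks {s = s} (valid⇒allDifferent {s} valid))

Givens : Board → List (ℕ × Fin 7) → Set
Givens s = All (λ (c , v) → s at c ≡ suc (toℕ v))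

onCells : List (ℕ × Fin 7) → List (Fin 37 × Fin 7)
onCells = map (λ (c , v) → cell c , v)

givens⇒satisfies : ∀ {s givens} → Givens s givens → Satisfies s (onCells givens)
givens⇒satisfies = All-map⁺ ∘ All.map (toℕ-injective ∘ ℕ.suc-injective)

centre : List (ℕ × Fin 7)
centre = (12 , # 0) ∷ (13 , # 1) ∷ (20 , # 2) ∷ (26 , # 3) ∷ (25 , # 4) ∷ (18 , # 5) ∷ (19 , # 6) ∷ []

seeds : ℕ → ℕ → List (ℕ × Fin 7)
seeds c c′ = (c , # 0) ∷ (c′ , # 0) ∷ []

Seeded : ℕ → ℕ → Board → Set
Seeded c c′ s = Valid s × StandardCenter s × s at c ≡ 1 × s at c′ ≡ 1

seeded⇒givens : ∀ {c c′ s} → Seeded c c′ s → Givens s (centre ++ seeds c c′)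
seeded⇒givens (_ , (e₁₂ , e₁₃ , e₂₀ , e₂₆ , e₂₅ , e₁₈ , e₁₉) , (e , e′)) =
  e₁₂ ∷ e₁₃ ∷ e₂₀ ∷ e₂₆ ∷ e₂₅ ∷ e₁₈ ∷ e₁₉ ∷ e ∷ e′ ∷ []

valid? : Decidable Valid
valid? s = all? distinct? rows ×-dec all? distinct? circles
  where
  distinct? : ∀ g → Dec (Distinct s g)
  distinct? g = allPairs? (λ x y → ¬? (x ≟ y)) (map (s at_) g)

seeded? : ∀ c c′ → Decidable (Seeded c c′)
seeded? c c′ s =
  valid? s ×-dec
  (s at 12 ≟ 1 ×-dec s at 13 ≟ 2 ×-dec s at 20 ≟ 3 ×-dec s at 26 ≟ 4 ×-dec
   s at 25 ≟ 5 ×-dec s at 18 ≟ 6 ×-dec s at 19 ≟ 7) ×-dec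
  (s at c ≟ 1 ×-dec s at c′ ≟ 1)

unique? : (L : List Board) → Dec (Unique L)
unique? = allPairs? (λ x y → ¬? (Vec.≡-dec _≟ᶠ_ x y))

exactlyBoards : ∀ {P : Board → Set} (L : List Board) {m} →
                (∀ {s} → P s → s ∈ L) → All P L → length L ≡ m → Unique L → ExactlyBoards m P
exactlyBoards L complete sound length≡m unique =
  L , length≡m , unique , λ s → mk⇔ (λ Ps → complete Ps) (All.lookup sound)

solutions : ℕ → ℕ → List Board
solutions c c′ = septokuSolve (onCells (centre ++ seeds c c′))

solutions-complete : ∀ c c′ {s} → Seeded c c′ s → s ∈ solutions c c′
solutions-complete c c′ {s} seeded@(valid , _) =
  septokuSolve-complete (onCells (centre ++ seeds c c′)) valid (givens⇒satisfies {s} (seeded⇒givens {c} {c′} {s} seeded))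

exactlySeeded : ∀ c c′ {m} → let L = filter (seeded? c c′) (solutions c c′) in
                {T (length L ≡ᵇ m)} → {True (unique? L)} → ExactlyBoards m (Seeded c c′)
exactlySeeded c c′ {m} {counted} {distinct} =
  exactlyBoards L (λ seeded → ∈-filter⁺ (seeded? c c′) (solutions-complete c c′ seeded) seeded)
                (all-filter (seeded? c c′) (solutions c c′))
                (ℕ.≡ᵇ⇒≡ (length L) m counted) (toWitness distinct)
  where
  L : List Board
  L = filter (seeded? c c′) (solutions c c′)

-- The hidden arguments of `exactlySeeded` are found by running the search.
opaque
  unfolding septokuSolve

  proposition2 : ExactlyBoards 4 (λ s → Valid s × StandardCenter s × SeedA s) ×
                 ExactlyBoards 4 (λ s → Valid s × StandardCenter s × SeedB s) ×
                 ExactlyBoards 4 (λ s → Valid s × StandardCenter s × SeedC s)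
  proposition2 = exactlySeeded 8 16 , exactlySeeded 8 22 , exactlySeeded 21 4
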